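{- Let $\langle \mathbf{A}_{\mathrm{d}}, \mathbf{A}, \iota\rangle$ be a (generalized) additive quantale with multiplication. Then it is distributively generated (i.e. $\mathbf{A}$ is generated as a (generalized) quantale by $\iota[\mathbf{A}_{\mathrm{d}}]$) if and only if the algebra $\langle A, \bigvee, +, \mathsf{0}, \cdot, \mathsf{1}\rangle$ is generated by $\iota[\mathbf{A}_{\mathrm{d}}]$.
   Context: Fix one of two parallel settings: in the plain setting "joins" means joins of arbitrary (possibly empty) families; in the generalized setting it means joins of non-empty families only. A (generalized) quantale is a structure $\mathbf{Q}=\langle Q,\bigvee,+,\mathsf{0}\rangle$ where $Q$ is a poset having all such joins, $\langle Q,+,\mathsf{0}\rangle$ is a (not necessarily commutative) monoid with $+$ order-preserving, and $x+\bigvee_i y_i=\bigvee_i(x+y_i)$, $(\bigvee_i x_i)+y=\bigvee_i(x_i+y)$ for all such families. A (generalized) additive quantale with multiplication is a triple $\langle \mathbf{A}_{\mathrm{d}},\mathbf{A},\iota\rangle$ where $\mathbf{A}_{\mathrm{d}}$ is a monoid, $\mathbf{A}$ is a (generalized) quantale which additionally carries a monoid structure $\langle A,\cdot,\mathsf{1}\rangle$, and $\iota\colon \mathbf{A}_{\mathrm{d}}\to\mathbf{A}$ is a monoid homomorphism, such that for all $a,b,c\in A$, all (non-empty, in the generalized setting) families $a_i$, and all $d\in\mathbf{A}_{\mathrm{d}}$: $(\bigvee_i a_i)\cdot b=\bigvee_i(a_i\cdot b)$, $(a+b)\cdot c=a\cdot c+b\cdot c$, $\mathsf{0}\cdot a=\mathsf{0}$,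 $\iota(d)\cdot\bigvee_i a_i=\bigvee_i(\iota(d)\cdot a_i)$, $\iota(d)\cdot(a+b)=\iota(d)\cdot a+\iota(d)\cdot b$, $\iota(d)\cdot\mathsf{0}=\mathsf{0}$. -}

module Defs where

open import Level using (Level; _⊔_; suc)
open import Data.Bool using (Bool; true; false)
open import Data.Unit.Polymorphic using (⊤)
open import Relation.Binary.PropositionalEquality using (_≡_)
open import Relation.Binary.Structures using (IsPartialOrder)
open import Algebra.Structures using (IsMonoid)

-- Which families are allowed to be joined.
--   generalized = false : plain setting, arbitrary (possibly empty) families.
--   generalized = true  : generalized setting, non-empty families only
--                         (non-emptiness witnessed by an element of the index type).
Admissible : {i : Level} → Bool → Set i → Set i
Admissible false I = ⊤
Admissible true  I = I

record AddQuantaleMult (gen : Bool) (c r i d : Level) : Set (suc (c ⊔ r ⊔ i ⊔ d)) where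
  infix  4 _≤_
  infixl 6 _+_
  infixl 7 _·_ _∙_
  field
    A        : Set c
    _≤_      : A → A → Set r
    ≤-isPartialOrder : IsPartialOrder _≡_ _≤_
    ⋁        : {I : Set i} → Admissible gen I → (I → A) → A
    ⋁-upper  : {I : Set i} (ne : Admissible gen I) (f : I → A) (j : I) → f j ≤ ⋁ ne f
    ⋁-least  : {I : Set i} (ne : Admissible gen I) (f : I → A) (x : A) →
               ((j : I) → f j ≤ x) → ⋁ ne f ≤ x
    _+_      : A → A → A
    𝟘        : A
    +-isMonoid : IsMonoid _≡_ _+_ 𝟘
    +-mono   : ∀ {x x′ y y′} → x ≤ x′ → y ≤ y′ → x + y ≤ x′ + y′
    +-distribˡ-⋁ : {I : Set i} (ne : Admissible gen I) (x : A) (f : I → A) →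
                   x + ⋁ ne f ≡ ⋁ ne (λ j → x + f j)
    +-distribʳ-⋁ : {I : Set i} (ne : Admissible gen I) (f : I → A) (y : A) →
                   ⋁ ne f + y ≡ ⋁ ne (λ j → f j + y)
    _·_      : A → A → A
    𝟙        : A
    ·-isMonoid : IsMonoid _≡_ _·_ 𝟙
    D        : Set d
    _∙_      : D → D → D
    ε        : D
    ∙-isMonoid : IsMonoid _≡_ _∙_ ε
    ι        : D → A
    ι-∙      : (x y : D) → ι (x ∙ y) ≡ ι x · ι y
    ι-ε      : ι ε ≡ 𝟙
    ·-distribʳ-⋁ : {I : Set i} (ne : Admissible gen I) (f : I → A) (b : A) →
                   ⋁ ne f · b ≡ ⋁ ne (λ j → f j · b)
    ·-distribʳ-+ : (a b c′ : A) → (a + b) · c′ ≡ a · c′ + b · c′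
    ·-zeroˡ      : (a : A) → 𝟘 · a ≡ 𝟘
    ι-distrib-⋁  : (x : D) {I : Set i} (ne : Admissible gen I) (f : I → A) →
                   ι x · ⋁ ne f ≡ ⋁ ne (λ j → ι x · f j)
    ι-distrib-+  : (x : D) (a b : A) → ι x · (a + b) ≡ ι x · a + ι x · b
    ι-zeroʳ      : (x : D) → ι x · 𝟘 ≡ 𝟘

module _ {gen : Bool} {c r i d : Level} (M : AddQuantaleMult gen c r i d) where
  open AddQuantaleMult M

  data InQuantaleGen : A → Set (c ⊔ suc i ⊔ d) where
    q-gen  : (x : D) → InQuantaleGen (ι x)
    q-join : {I : Set i} (ne : Admissible gen I) (f : I → A) →
             ((j : I) → InQuantaleGen (f j)) → InQuantaleGen (⋁ ne f)
    q-plus : {a b : A} → InQuantaleGen a → InQuantaleGen b → InQuantaleGen (a + b)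
    q-zero : InQuantaleGen 𝟘

  data InAlgebraGen : A → Set (c ⊔ suc i ⊔ d) where
    a-gen   : (x : D) → InAlgebraGen (ι x)
    a-join  : {I : Set i} (ne : Admissible gen I) (f : I → A) →
              ((j : I) → InAlgebraGen (f j)) → InAlgebraGen (⋁ ne f)
    a-plus  : {a b : A} → InAlgebraGen a → InAlgebraGen b → InAlgebraGen (a + b)
    a-zero  : InAlgebraGen 𝟘
    a-times : {a b : A} → InAlgebraGen a → InAlgebraGen b → InAlgebraGen (a · b)
    a-one   : InAlgebraGen 𝟙

  DistributivelyGenerated : Set (c ⊔ suc i ⊔ d)
  DistributivelyGenerated = (a : A) → InQuantaleGen a

  AlgebraGenerated : Set (c ⊔ suc i ⊔ d)
  AlgebraGenerated = (a : A) → InAlgebraGen a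

-- The sub-quantale generated by ι[A_d] already contains 𝟙 = ι ε and is closed
-- under multiplication, hence it is the whole generated subalgebra. Closure is
-- by induction on the left factor, using that · distributes over ⋁, + and 𝟘 on
-- the right; a generator ι x on the left is handled by induction on the right
-- factor, using the left distributivity of ι x and ι x · ι y = ι (x ∙ y).
module Submission where

open import Defs
open import Level using (Level)
open import Data.Bool using (Bool)
open import Function.Bundles using (_⇔_; mk⇔)
open import Relation.Binary.PropositionalEquality using (subst; sym)

module _ {gen : Bool} {c r i d : Level} (M : AddQuantaleMult gen c r i d) where
  open AddQuantaleMult M

  private
    Q : A → Set _
    Q = InQuantaleGen M

  InQuantaleGen⇒InAlgebraGen : ∀ {a} → Q a → InAlgebraGen M a
  InQuantaleGen⇒InAlgebraGen (q-gen x)       = a-gen x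
  InQuantaleGen⇒InAlgebraGen (q-join ne f h) = a-join ne f (λ j → InQuantaleGen⇒InAlgebraGen (h j))
  InQuantaleGen⇒InAlgebraGen (q-plus p q)    = a-plus (InQuantaleGen⇒InAlgebraGen p) (InQuantaleGen⇒InAlgebraGen q)
  InQuantaleGen⇒InAlgebraGen q-zero          = a-zero

  InQuantaleGen-ι· : ∀ x {b} → Q b → Q (ι x · b)
  InQuantaleGen-ι· x (q-gen y) =
    subst Q (ι-∙ x y) (q-gen (x ∙ y))
  InQuantaleGen-ι· x (q-join ne f h) =
    subst Q (sym (ι-distrib-⋁ x ne f)) (q-join ne (λ j → ι x · f j) (λ j → InQuantaleGen-ι· x (h j)))
  InQuantaleGen-ι· x (q-plus p q) =
    subst Q (sym (ι-distrib-+ x _ _)) (q-plus (InQuantaleGen-ι· x p) (InQuantaleGen-ι· x q))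
  InQuantaleGen-ι· x q-zero =
    subst Q (sym (ι-zeroʳ x)) q-zero

  InQuantaleGen-· : ∀ {a b} → Q a → Q b → Q (a · b)
  InQuantaleGen-· (q-gen x) q = InQuantaleGen-ι· x q
  InQuantaleGen-· {b = b} (q-join ne f h) q =
    subst Q (sym (·-distribʳ-⋁ ne f b)) (q-join ne (λ j → f j · b) (λ j → InQuantaleGen-· (h j) q))
  InQuantaleGen-· (q-plus p p′) q =
    subst Q (sym (·-distribʳ-+ _ _ _)) (q-plus (InQuantaleGen-· p q) (InQuantaleGen-· p′ q))
  InQuantaleGen-· q-zero q =
    subst Q (sym (·-zeroˡ _)) q-zero

  InQuantaleGen-𝟙 : Q 𝟙
  InQuantaleGen-𝟙 = subst Q ι-ε (q-gen ε)

  InAlgebraGen⇒InQuantaleGen : ∀ {a} → InAlgebraGen M a → Q a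
  InAlgebraGen⇒InQuantaleGen (a-gen x)       = q-gen x
  InAlgebraGen⇒InQuantaleGen (a-join ne f h) = q-join ne f (λ j → InAlgebraGen⇒InQuantaleGen (h j))
  InAlgebraGen⇒InQuantaleGen (a-plus p q)    = q-plus (InAlgebraGen⇒InQuantaleGen p) (InAlgebraGen⇒InQuantaleGen q)
  InAlgebraGen⇒InQuantaleGen a-zero          = q-zero
  InAlgebraGen⇒InQuantaleGen (a-times p q)   = InQuantaleGen-· (InAlgebraGen⇒InQuantaleGen p) (InAlgebraGen⇒InQuantaleGen q)
  InAlgebraGen⇒InQuantaleGen a-one           = InQuantaleGen-𝟙

lemma2p12 : {c r i d : Level} (gen : Bool) (M : AddQuantaleMult gen c r i d) →
            DistributivelyGenerated M ⇔ AlgebraGenerated M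
lemma2p12 gen M = mk⇔ (λ qgen a → InQuantaleGen⇒InAlgebraGen M (qgen a))
                      (λ agen a → InAlgebraGen⇒InQuantaleGen M (agen a))
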